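{- For every formula $A$: if $\mathsf{H_C}\vdash A$ then $\mathsf{D_C}\vdash^{<\omega^2}_{\omega^2}A$.
   Context: Fix $h\ge1$ agents. Formulas: $A::=p\mid\bar p\mid A\vee A\mid A\wedge A\mid\Diamond_iA\mid\Box_iA\mid\widetilde{\mathsf C}A\mid\mathsf CA$ ($1\le i\le h$), $\widetilde{\mathsf C}$ the De Morgan dual of $\mathsf C$ (common knowledge); $\bar A$ by De Morgan laws, $A\supset B:=\bar A\vee B$. $\Box A:=\Box_1A\wedge\dots\wedge\Box_hA$, $\Diamond A:=\Diamond_1A\vee\dots\vee\Diamond_hA$, $\Box^k,\Diamond^k$ iterations. Rank: $rk(p)=rk(\bar p)=0$, $rk(A\wedge B)=rk(A\vee B)=\max(rk A,rk B)+1$, $rk(\Box_iA)=rk(\Diamond_iA)=rk(A)+1$, $rk(\mathsf CA)=rk(\widetilde{\mathsf C}A)=\omega+rk(A)$. $\mathsf{H_C}$ is some Hilbert system for classical propositional logic extended by the axioms $\Box_iA\wedge\Box_i(A\supset B)\supset\Box_iB$ and $\mathsf CA\supset(\Box A\wedge\Box\mathsf CA)$ and the rules: from $B\supset(\Box A\wedge\Box B)$ infer $B\supset\mathsf CA$; from $A$ and $A\supset B$ infer $B$; from $A$ infer $\Box_iA$. Nested sequents: finite multisets of formulas and boxed sequents $[\Delta]_i$; contexts $\Gamma\{\ \}$ as usual. System $\mathsf{D_C}$ (premises / conclusion): axiom $\Gamma\{p,\bar p\}$; $\wedge$: $\Gamma\{A\},\Gamma\{B\}/\Gamma\{A\wedge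 B\}$; $\vee$: $\Gamma\{A,B\}/\Gamma\{A\vee B\}$; $\Box_i$: $\Gamma\{[A]_i\}/\Gamma\{\Box_iA\}$; $\Diamond_i$: $\Gamma\{\Diamond_iA,[\Delta,A]_i\}/\Gamma\{\Diamond_iA,[\Delta]_i\}$; $\mathsf C$: premises $\Gamma\{\Box^kA\}$, all $k\ge1$ / $\Gamma\{\mathsf CA\}$; $\widetilde{\mathsf C}$: $\Gamma\{\widetilde{\mathsf C}A,\Diamond^kA\}/\Gamma\{\widetilde{\mathsf C}A\}$ (some $k\ge1$); cut: $\Gamma\{A\},\Gamma\{\bar A\}/\Gamma\{\emptyset\}$ of rank $rk(A)$. Proofs: well-founded possibly infinitely branching trees with axiom leaves; depth = least ordinal greater than depths of immediate subproofs. $\mathsf{D_C}\vdash^{\alpha}_\gamma\Gamma$: proof in $\mathsf{D_C}$ plus cuts of rank $<\gamma$ of depth $\le\alpha$; $\mathsf{D_C}\vdash^{<\alpha}_\gamma\Gamma$ means $\mathsf{D_C}\vdash^{\alpha_0}_\gamma\Gamma$ for some $\alpha_0<\alpha$. -}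

module Defs where

open import Data.Nat using (ℕ; zero; suc; _<_; _⊔_; _<ᵇ_)
open import Data.Fin using (Fin; zero; suc)
open import Data.Bool using (Bool; true; false; not; _∧_; _∨_)
open import Data.List using (List; []; _∷_; _++_)
open import Data.Product using (_×_; Σ; ∃-syntax; _,_)
open import Data.Sum using (_⊎_)
open import Data.Unit using (⊤)
open import Relation.Binary.PropositionalEquality using (_≡_)

-- Formulas (negation normal form) for h = suc n agents, agents = Fin (suc n)

data Fml (n : ℕ) : Set where
  atom  : ℕ → Fml n
  natom : ℕ → Fml n
  _∨f_  : Fml n → Fml n → Fml n
  _∧f_  : Fml n → Fml n → Fml n
  dia   : Fin (suc n) → Fml n → Fml n
  box   : Fin (suc n) → Fml n → Fml n
  cdual : Fml n → Fml n
  ck    : Fml n → Fml n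

infixr 6 _∧f_
infixr 5 _∨f_

neg : ∀ {n} → Fml n → Fml n
neg (atom p)  = natom p
neg (natom p) = atom p
neg (A ∨f B)  = neg A ∧f neg B
neg (A ∧f B)  = neg A ∨f neg B
neg (dia i A) = box i (neg A)
neg (box i A) = dia i (neg A)
neg (cdual A) = ck (neg A)
neg (ck A)    = cdual (neg A)

infixr 4 _⊃_
_⊃_ : ∀ {n} → Fml n → Fml n → Fml n
A ⊃ B = neg A ∨f B

bigAnd : ∀ {m n} → (Fin (suc m) → Fml n) → Fml n
bigAnd {zero}  f = f zero
bigAnd {suc m} f = f zero ∧f bigAnd (λ j → f (suc j))

bigOr : ∀ {m n} → (Fin (suc m) → Fml n) → Fml n
bigOr {zero}  f = f zero
bigOr {suc m} f = f zero ∨f bigOr (λ j → f (suc j))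

□ : ∀ {n} → Fml n → Fml n
□ A = bigAnd (λ i → box i A)

◇ : ∀ {n} → Fml n → Fml n
◇ A = bigOr (λ i → dia i A)

□^ : ∀ {n} → ℕ → Fml n → Fml n
□^ zero    A = A
□^ (suc k) A = □ (□^ k A)

◇^ : ∀ {n} → ℕ → Fml n → Fml n
◇^ zero    A = A
◇^ (suc k) A = ◇ (◇^ k A)

-- Ordinals below ω², ω·a + b represented as (a , b), lexicographic order

Ord : Set
Ord = ℕ × ℕ

_<o_ : Ord → Ord → Set
(a , b) <o (c , d) = (a < c) ⊎ ((a ≡ c) × (b < d))

maxo : Ord → Ord → Ord
maxo (a , b) (c , d) with a <ᵇ c | c <ᵇ a
... | true  | _     = (c , d)
... | false | true  = (a , b)
... | false | false = (a , b ⊔ d)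

sucₒ : Ord → Ord
sucₒ (a , b) = (a , suc b)

rk : ∀ {n} → Fml n → Ord
rk (atom p)  = (0 , 0)
rk (natom p) = (0 , 0)
rk (A ∨f B)  = sucₒ (maxo (rk A) (rk B))
rk (A ∧f B)  = sucₒ (maxo (rk A) (rk B))
rk (dia i A) = sucₒ (rk A)
rk (box i A) = sucₒ (rk A)
rk (cdual A) with rk A
... | (a , b) = (suc a , b)             -- ω + (ω·a + b) = ω·(1+a) + b
rk (ck A) with rk A
... | (a , b) = (suc a , b)

-- bounds on cut ranks: ordinals ≤ ω²
data CutBound : Set where
  below : Ord → CutBound
  ω²    : CutBound

_<γ_ : Ord → CutBound → Set
r <γ below g = r <o g
r <γ ω²      = ⊤

-- Hilbert system H_C.  Classical propositional base: all instances of
-- propositional tautologies (modal/C-formulas treated as propositional atoms).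

eval : ∀ {n} → (Fml n → Bool) → Fml n → Bool
eval V (atom p)  = V (atom p)
eval V (natom p) = not (V (atom p))
eval V (A ∨f B)  = eval V A ∨ eval V B
eval V (A ∧f B)  = eval V A ∧ eval V B
eval V (dia i A) = not (V (box i (neg A)))
eval V (box i A) = V (box i A)
eval V (cdual A) = not (V (ck (neg A)))
eval V (ck A)    = V (ck A)

Taut : ∀ {n} → Fml n → Set
Taut {n} A = (V : Fml n → Bool) → eval V A ≡ true

data HC⊢ {n : ℕ} : Fml n → Set where
  taut : ∀ {A} → Taut A → HC⊢ A
  kax  : ∀ {i A B} → HC⊢ ((box i A ∧f box i (A ⊃ B)) ⊃ box i B)
  cax  : ∀ {A} → HC⊢ (ck A ⊃ (□ A ∧f □ (ck A)))
  ind  : ∀ {A B} → HC⊢ (B ⊃ (□ A ∧f □ B)) → HC⊢ (B ⊃ ck A)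
  mp   : ∀ {A B} → HC⊢ A → HC⊢ (A ⊃ B) → HC⊢ B
  nec  : ∀ {i A} → HC⊢ A → HC⊢ (box i A)

-- Nested sequents (lists taken up to the multiset equivalence _≈_ below)

data Item (n : ℕ) : Set where
  fml : Fml n → Item n
  bx  : Fin (suc n) → List (Item n) → Item n

Seq : ℕ → Set
Seq n = List (Item n)

data _≈_ {n : ℕ} : Seq n → Seq n → Set
data _≈i_ {n : ℕ} : Item n → Item n → Set

data _≈_ {n} where
  nil   : [] ≈ []
  cons  : ∀ {x y Γ Δ} → x ≈i y → Γ ≈ Δ → (x ∷ Γ) ≈ (y ∷ Δ)
  swap  : ∀ {x y Γ} → (x ∷ y ∷ Γ) ≈ (y ∷ x ∷ Γ)
  trans : ∀ {Γ Δ Σ} → Γ ≈ Δ → Δ ≈ Σ → Γ ≈ Σ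

data _≈i_ {n} where
  fmlr : ∀ {A} → fml A ≈i fml A
  bxc  : ∀ {i Γ Δ} → Γ ≈ Δ → bx i Γ ≈i bx i Δ

-- contexts Γ{ }:  Δ , { }   or   Δ , [Γ'{ }]ᵢ
data Ctx (n : ℕ) : Set where
  top   : Seq n → Ctx n
  inBox : Seq n → Fin (suc n) → Ctx n → Ctx n

fill : ∀ {n} → Ctx n → Seq n → Seq n
fill (top Δ)       X = Δ ++ X
fill (inBox Δ i C) X = Δ ++ (bx i (fill C X) ∷ [])

-- D_C + cuts of rank < γ, with depth ≤ α:   DC γ ⊢[ α ] Γ
-- (each premise has its own depth β < α)

data DC_⊢[_]_ {n : ℕ} (γ : CutBound) : Ord → Seq n → Set where
  ax   : ∀ {α Γ} C p → Γ ≈ fill C (fml (atom p) ∷ fml (natom p) ∷ []) →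
         DC γ ⊢[ α ] Γ
  ∧r   : ∀ {α Γ} C A B β₁ β₂ → β₁ <o α → β₂ <o α →
         DC γ ⊢[ β₁ ] fill C (fml A ∷ []) → DC γ ⊢[ β₂ ] fill C (fml B ∷ []) →
         Γ ≈ fill C (fml (A ∧f B) ∷ []) → DC γ ⊢[ α ] Γ
  ∨r   : ∀ {α Γ} C A B β → β <o α →
         DC γ ⊢[ β ] fill C (fml A ∷ fml B ∷ []) →
         Γ ≈ fill C (fml (A ∨f B) ∷ []) → DC γ ⊢[ α ] Γ
  □r   : ∀ {α Γ} C i A β → β <o α →
         DC γ ⊢[ β ] fill C (bx i (fml A ∷ []) ∷ []) →
         Γ ≈ fill C (fml (box i A) ∷ []) → DC γ ⊢[ α ] Γ
  ◇r   : ∀ {α Γ} C i A Δ β → β <o α →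
         DC γ ⊢[ β ] fill C (fml (dia i A) ∷ bx i (Δ ++ fml A ∷ []) ∷ []) →
         Γ ≈ fill C (fml (dia i A) ∷ bx i Δ ∷ []) → DC γ ⊢[ α ] Γ
  Cr   : ∀ {α Γ} C A →
         ((k : ℕ) → ∃[ β ] (β <o α × DC γ ⊢[ β ] fill C (fml (□^ (suc k) A) ∷ []))) →
         Γ ≈ fill C (fml (ck A) ∷ []) → DC γ ⊢[ α ] Γ
  C̃r   : ∀ {α Γ} C A k β → β <o α →
         DC γ ⊢[ β ] fill C (fml (cdual A) ∷ fml (◇^ (suc k) A) ∷ []) →
         Γ ≈ fill C (fml (cdual A) ∷ []) → DC γ ⊢[ α ] Γ
  cut  : ∀ {α Γ} C A β₁ β₂ → rk A <γ γ → β₁ <o α → β₂ <o α →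
         DC γ ⊢[ β₁ ] fill C (fml A ∷ []) → DC γ ⊢[ β₂ ] fill C (fml (neg A) ∷ []) →
         Γ ≈ fill C [] → DC γ ⊢[ α ] Γ

-- Write ⊩[ a ] Γ for "Γ has a derivation of depth below ω·(a+1)". Every rule but C preserves
-- such a bound, and C raises it by one ω because its infinitely many premises □ᵏ⁺¹A must share
-- a bound; so it suffices to derive every Hilbert theorem at some finite level a, by induction
-- on its Hilbert derivation. Identity sequents A, Ā are derivable for all A (for CA, from the
-- premises □ᵏ⁺¹A, ◇ᵏ⁺¹Ā closed by the C̃-rule). A tautology is derived clause by clause from
-- its conjunctive normal form: a clause true under every valuation contains a complementary
-- pair, since otherwise the valuation falsifying all its literals refutes it. Modus ponens is
-- a cut. For the induction rule, B ⊃ □A ∧ □B gives B ⊃ □ᵏ⁺¹A for all k at one common level,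
-- and the C-rule turns these into B ⊃ CA.
module Submission where

open import Defs
open import Data.Bool using (Bool; T; not)
open import Data.Bool.Properties using (T-≡; T-∧; T-∨)
open import Data.Empty using (⊥; ⊥-elim)
open import Data.Fin using (Fin; zero; suc)
import Data.Fin.Properties as Fin
open import Data.List using (List; []; _∷_; _++_; [_]; map; cartesianProductWith)
open import Data.List.Properties using (++-assoc; ++-identityʳ; map-++)
open import Data.List.Membership.Propositional using (_∈_; find)
open import Data.List.Membership.Propositional.Properties
  using (∈-++⁻; ∈-++⁺ˡ; ∈-++⁺ʳ; ∈-∃++; ∈-cartesianProductWith⁺; ∈-cartesianProductWith⁻)
open import Data.List.Relation.Binary.Permutation.Propositional
  using (_↭_; refl; prep; swap; trans; ↭-sym; ↭-trans; ↭-reflexive)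
import Data.List.Relation.Binary.Permutation.Propositional.Properties as ↭
open import Data.List.Relation.Unary.Any using (Any; here; there)
import Data.List.Relation.Unary.Any.Properties as Any
open import Data.Nat using (ℕ; zero; suc; _≤_; _⊔_; s≤s)
import Data.Nat.Properties as ℕ
open import Data.Product using (∃-syntax; _×_; _,_)
open import Data.Sum using (_⊎_; inj₁; inj₂; [_,_]′)
open import Data.Unit using (⊤; tt)
open import Function using (_∘_; Equivalence)
open import Relation.Binary.Definitions using (DecidableEquality)
open import Relation.Nullary using (yes; no)
open import Relation.Nullary.Decidable using (⌊_⌋; toWitness; toWitnessFalse)
open import Relation.Binary.PropositionalEquality
  using (_≡_; _≢_; refl; sym; cong; cong₂; subst; subst₂)
import Relation.Binary.PropositionalEquality as ≡

private variable
  n a a′ b : ℕ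
  i : Fin (suc n)
  A B X Y Z Z′ : Fml n
  Γ Δ Σ : Seq n
  α β : Ord
  γ : CutBound

≈-refl : (Γ : Seq n) → Γ ≈ Γ
≈i-refl : (x : Item n) → x ≈i x
≈-refl []      = nil
≈-refl (x ∷ Γ) = cons (≈i-refl x) (≈-refl Γ)
≈i-refl (fml A)  = fmlr
≈i-refl (bx i Γ) = bxc (≈-refl Γ)

≈-sym : Γ ≈ Δ → Δ ≈ Γ
≈i-sym : {x y : Item n} → x ≈i y → y ≈i x
≈-sym nil         = nil
≈-sym (cons p q)  = cons (≈i-sym p) (≈-sym q)
≈-sym swap        = swap
≈-sym (trans p q) = trans (≈-sym q) (≈-sym p)
≈i-sym fmlr    = fmlr
≈i-sym (bxc p) = bxc (≈-sym p)

↭⇒≈ : Γ ↭ Δ → Γ ≈ Δ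
↭⇒≈ refl          = ≈-refl _
↭⇒≈ (prep x p)    = cons (≈i-refl x) (↭⇒≈ p)
↭⇒≈ (swap x y p)  = trans swap (cons (≈i-refl y) (cons (≈i-refl x) (↭⇒≈ p)))
↭⇒≈ (trans p q)   = trans (↭⇒≈ p) (↭⇒≈ q)

rotate : (Δ : Seq n) → (Δ ++ Γ) ≈ (Γ ++ Δ)
rotate {Γ = Γ} Δ = ↭⇒≈ (↭.++-comm Δ Γ)

++⁺ˡ : (Δ : Seq n) → Γ ≈ Σ → (Δ ++ Γ) ≈ (Δ ++ Σ)
++⁺ˡ []      p = p
++⁺ˡ (x ∷ Δ) p = cons (≈i-refl x) (++⁺ˡ Δ p)

fill-cong : (D : Ctx n) → Γ ≈ Δ → fill D Γ ≈ fill D Δ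
fill-cong (top Σ)       p = ++⁺ˡ Σ p
fill-cong (inBox Σ i D) p = ++⁺ˡ Σ (cons (bxc (fill-cong D p)) nil)

_⊚_ : Ctx n → Ctx n → Ctx n
top Δ       ⊚ top Σ       = top (Δ ++ Σ)
top Δ       ⊚ inBox Σ i C = inBox (Δ ++ Σ) i C
inBox Δ i D ⊚ C           = inBox Δ i (D ⊚ C)

fill-⊚ : (D C : Ctx n) (Γ : Seq n) → fill D (fill C Γ) ≡ fill (D ⊚ C) Γ
fill-⊚ (top Δ)       (top Σ)       Γ = sym (++-assoc Δ Σ Γ)
fill-⊚ (top Δ)       (inBox Σ i C) Γ = sym (++-assoc Δ Σ _)
fill-⊚ (inBox Δ i D) C             Γ = cong (λ Π → Δ ++ [ bx i Π ]) (fill-⊚ D C Γ)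

reverse₃ : {x y z : Item n} → (x ∷ y ∷ z ∷ []) ≈ (z ∷ y ∷ x ∷ [])
reverse₃ = trans swap (trans (cons (≈i-refl _) swap) swap)

exchange : DC γ ⊢[ α ] Γ → Γ ≈ Δ → DC γ ⊢[ α ] Δ
exchange (ax C p e)                      q = ax C p (trans (≈-sym q) e)
exchange (∧r C A B β₁ β₂ l₁ l₂ d₁ d₂ e)  q = ∧r C A B β₁ β₂ l₁ l₂ d₁ d₂ (trans (≈-sym q) e)
exchange (∨r C A B β l d e)              q = ∨r C A B β l d (trans (≈-sym q) e)
exchange (□r C i A β l d e)              q = □r C i A β l d (trans (≈-sym q) e)
exchange (◇r C i A Δ β l d e)            q = ◇r C i A Δ β l d (trans (≈-sym q) e)
exchange (Cr C A ds e)                   q = Cr C A ds (trans (≈-sym q) e)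
exchange (C̃r C A k β l d e)              q = C̃r C A k β l d (trans (≈-sym q) e)
exchange (cut C A β₁ β₂ r l₁ l₂ d₁ d₂ e) q = cut C A β₁ β₂ r l₁ l₂ d₁ d₂ (trans (≈-sym q) e)

raise-depth : (∀ {δ} → δ <o β → δ <o α) → DC γ ⊢[ β ] Γ → DC γ ⊢[ α ] Γ
raise-depth β≤α (ax C p e)                      = ax C p e
raise-depth β≤α (∧r C A B β₁ β₂ l₁ l₂ d₁ d₂ e)  = ∧r C A B β₁ β₂ (β≤α l₁) (β≤α l₂) d₁ d₂ e
raise-depth β≤α (∨r C A B β l d e)              = ∨r C A B β (β≤α l) d e
raise-depth β≤α (□r C i A β l d e)              = □r C i A β (β≤α l) d e
raise-depth β≤α (◇r C i A Δ β l d e)            = ◇r C i A Δ β (β≤α l) d e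
raise-depth β≤α (Cr C A ds e)                   =
  Cr C A (λ k → let δ , l , d = ds k in δ , β≤α l , d) e
raise-depth β≤α (C̃r C A k β l d e)              = C̃r C A k β (β≤α l) d e
raise-depth β≤α (cut C A β₁ β₂ r l₁ l₂ d₁ d₂ e) = cut C A β₁ β₂ r (β≤α l₁) (β≤α l₂) d₁ d₂ e

weaken : (D : Ctx n) → DC γ ⊢[ α ] Γ → DC γ ⊢[ α ] fill D Γ
weaken {γ = γ} D = go
  where
    go : DC γ ⊢[ α ] Γ → DC γ ⊢[ α ] fill D Γ
    inside : (C : Ctx _) → DC γ ⊢[ α ] fill C Γ → DC γ ⊢[ α ] fill (D ⊚ C) Γ
    inside C d = subst (DC γ ⊢[ _ ]_) (fill-⊚ D C _) (go d)
    conclusion : (C : Ctx _) → Γ ≈ fill C Δ → fill D Γ ≈ fill (D ⊚ C) Δ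
    conclusion C e = trans (fill-cong D e) (↭⇒≈ (↭-reflexive (fill-⊚ D C _)))

    go (ax C p e) = ax (D ⊚ C) p (conclusion C e)
    go (∧r C A B β₁ β₂ l₁ l₂ d₁ d₂ e) =
      ∧r (D ⊚ C) A B β₁ β₂ l₁ l₂ (inside C d₁) (inside C d₂) (conclusion C e)
    go (∨r C A B β l d e) = ∨r (D ⊚ C) A B β l (inside C d) (conclusion C e)
    go (□r C i A β l d e) = □r (D ⊚ C) i A β l (inside C d) (conclusion C e)
    go (◇r C i A Δ β l d e) = ◇r (D ⊚ C) i A Δ β l (inside C d) (conclusion C e)
    go (Cr C A ds e) =
      Cr (D ⊚ C) A (λ k → let δ , l , d = ds k in δ , l , inside C d) (conclusion C e)
    go (C̃r C A k β l d e) = C̃r (D ⊚ C) A k β l (inside C d) (conclusion C e)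
    go (cut C A β₁ β₂ r l₁ l₂ d₁ d₂ e) =
      cut (D ⊚ C) A β₁ β₂ r l₁ l₂ (inside C d₁) (inside C d₂) (conclusion C e)

<o-suc : (a , b) <o (a , suc b)
<o-suc = inj₂ (refl , ℕ.n<1+n _)

<o-⊔ˡ : ∀ b′ → (a , b) <o (a , suc (b ⊔ b′))
<o-⊔ˡ b′ = inj₂ (refl , s≤s (ℕ.m≤m⊔n _ b′))

<o-⊔ʳ : ∀ b′ → (a , b′) <o (a , suc (b ⊔ b′))
<o-⊔ʳ b′ = inj₂ (refl , s≤s (ℕ.m≤n⊔m _ b′))

<o-limit : (a , b) <o (suc a , 0)
<o-limit = inj₁ (ℕ.n<1+n _)

<o-monoˡ : a ≤ a′ → α <o (a , b) → α <o (a′ , b)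
<o-monoˡ a≤a′ (inj₁ c<a) = inj₁ (ℕ.<-≤-trans c<a a≤a′)
<o-monoˡ a≤a′ (inj₂ (refl , d<b)) with ℕ.m≤n⇒m<n∨m≡n a≤a′
... | inj₁ a<a′ = inj₁ a<a′
... | inj₂ refl = inj₂ (refl , d<b)

-- ⊩[ a ] Γ: Γ has a derivation of depth (a , b) = ω·a + b for some b, i.e. below ω·(a + 1).
infix 4 ⊩[_]_ ⊩_

⊩[_]_ : ℕ → Seq n → Set
⊩[ a ] Γ = ∃[ b ] DC ω² ⊢[ (a , b) ] Γ

⊩_ : Seq n → Set
⊩ Γ = ∃[ a ] ⊩[ a ] Γ

⊩-mono : a ≤ a′ → ⊩[ a ] Γ → ⊩[ a′ ] Γ
⊩-mono a≤a′ (b , d) = b , raise-depth (<o-monoˡ a≤a′) d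

⊩-≈ : ⊩[ a ] Γ → Γ ≈ Δ → ⊩[ a ] Δ
⊩-≈ (b , d) p = b , exchange d p

⊩-weaken : (D : Ctx n) → ⊩[ a ] Γ → ⊩[ a ] fill D Γ
⊩-weaken D (b , d) = b , weaken D d

⊩-lift₁ : (∀ {a} → ⊩[ a ] Γ → ⊩[ a ] Δ) → ⊩ Γ → ⊩ Δ
⊩-lift₁ f (a , d) = a , f d

⊩-common : ⊩ Γ → ⊩ Δ → ∃[ a ] (⊩[ a ] Γ × ⊩[ a ] Δ)
⊩-common (a , d) (a′ , e) = a ⊔ a′ , ⊩-mono (ℕ.m≤m⊔n a a′) d , ⊩-mono (ℕ.m≤n⊔m a a′) e

⊩-lift₂ : (∀ {a} → ⊩[ a ] Γ → ⊩[ a ] Δ → ⊩[ a ] Σ) → ⊩ Γ → ⊩ Δ → ⊩ Σ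
⊩-lift₂ f d e = let a , d′ , e′ = ⊩-common d e in a , f d′ e′

exchange⊩ : ⊩ Γ → Γ ≈ Δ → ⊩ Δ
exchange⊩ d p = ⊩-lift₁ (λ e → ⊩-≈ e p) d

weaken⊩ : (D : Ctx n) → ⊩ Γ → ⊩ fill D Γ
weaken⊩ D = ⊩-lift₁ (⊩-weaken D)

∨⊩ : ⊩[ a ] fml A ∷ fml B ∷ Γ → ⊩[ a ] fml (A ∨f B) ∷ Γ
∨⊩ {Γ = Γ} (b , d) =
  suc b , ∨r (top Γ) _ _ _ <o-suc (exchange d (rotate (_ ∷ _ ∷ []))) (rotate [ _ ])

∧⊩ : ⊩[ a ] fml A ∷ Γ → ⊩[ a ] fml B ∷ Γ → ⊩[ a ] fml (A ∧f B) ∷ Γ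
∧⊩ {Γ = Γ} (b , d) (b′ , e) =
  suc (b ⊔ b′) , ∧r (top Γ) _ _ _ _ (<o-⊔ˡ b′) (<o-⊔ʳ b′)
    (exchange d (rotate [ _ ])) (exchange e (rotate [ _ ])) (rotate [ _ ])

cut⊩ : ⊩[ a ] fml A ∷ Γ → ⊩[ a ] fml (neg A) ∷ Γ → ⊩[ a ] Γ
cut⊩ {Γ = Γ} (b , d) (b′ , e) =
  suc (b ⊔ b′) , cut (top Γ) _ _ _ tt (<o-⊔ˡ b′) (<o-⊔ʳ b′)
    (exchange d (rotate [ _ ])) (exchange e (rotate [ _ ])) (↭⇒≈ (↭-sym (↭.++-identityʳ Γ)))

□⊩ : ⊩[ a ] bx i [ fml A ] ∷ Γ → ⊩[ a ] fml (box i A) ∷ Γ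
□⊩ {Γ = Γ} (b , d) =
  suc b , □r (top Γ) _ _ _ <o-suc (exchange d (rotate [ _ ])) (rotate [ _ ])

◇⊩ : ⊩[ a ] fml (dia i A) ∷ bx i (Δ ++ [ fml A ]) ∷ Γ → ⊩[ a ] fml (dia i A) ∷ bx i Δ ∷ Γ
◇⊩ {Γ = Γ} (b , d) =
  suc b , ◇r (top Γ) _ _ _ _ <o-suc (exchange d (rotate (_ ∷ _ ∷ []))) (rotate (_ ∷ _ ∷ []))

C̃⊩ : ∀ k → ⊩[ a ] fml (cdual A) ∷ fml (◇^ (suc k) A) ∷ Γ → ⊩[ a ] fml (cdual A) ∷ Γ
C̃⊩ {Γ = Γ} k (b , d) =
  suc b , C̃r (top Γ) _ k _ <o-suc (exchange d (rotate (_ ∷ _ ∷ []))) (rotate [ _ ])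

C⊩ : (D : Ctx n) → (∀ k → ⊩[ a ] fill D [ fml (□^ (suc k) A) ]) →
     ⊩[ suc a ] fill D [ fml (ck A) ]
C⊩ D ds = 0 , Cr D _ (λ k → let b , d = ds k in (_ , b) , <o-limit , d) (≈-refl _)

neg-involutive : (A : Fml n) → neg (neg A) ≡ A
neg-involutive (atom p)  = refl
neg-involutive (natom p) = refl
neg-involutive (A ∨f B)  = cong₂ _∨f_ (neg-involutive A) (neg-involutive B)
neg-involutive (A ∧f B)  = cong₂ _∧f_ (neg-involutive A) (neg-involutive B)
neg-involutive (dia i A) = cong (dia i) (neg-involutive A)
neg-involutive (box i A) = cong (box i) (neg-involutive A)
neg-involutive (cdual A) = cong cdual (neg-involutive A)
neg-involutive (ck A)    = cong ck (neg-involutive A)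

neg-irreflexive : (A : Fml n) → A ≢ neg A
neg-irreflexive (atom _)  ()
neg-irreflexive (natom _) ()
neg-irreflexive (_ ∨f _)  ()
neg-irreflexive (_ ∧f _)  ()
neg-irreflexive (dia _ _) ()
neg-irreflexive (box _ _) ()
neg-irreflexive (cdual _) ()
neg-irreflexive (ck _)    ()

neg-bigAnd : ∀ {m} (f : Fin (suc m) → Fml n) → neg (bigAnd f) ≡ bigOr (neg ∘ f)
neg-bigAnd {m = zero}  f = refl
neg-bigAnd {m = suc m} f = cong (neg (f zero) ∨f_) (neg-bigAnd (f ∘ suc))

neg-□^ : ∀ k (A : Fml n) → neg (□^ k A) ≡ ◇^ k (neg A)
neg-□^ zero    A = refl
neg-□^ (suc k) A = ≡.trans (neg-bigAnd (λ i → box i (□^ k A))) (cong ◇ (neg-□^ k A))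

□^-□ : ∀ k (A : Fml n) → □^ k (□ A) ≡ □^ (suc k) A
□^-□ zero    A = refl
□^-□ (suc k) A = cong □ (□^-□ k A)

⋀⊩ : ∀ {m} (f : Fin (suc m) → Fml n) → (∀ j → ⊩[ a ] fml (f j) ∷ Γ) →
     ⊩[ a ] fml (bigAnd f) ∷ Γ
⋀⊩ {m = zero}  f ds = ds zero
⋀⊩ {m = suc m} f ds = ∧⊩ (ds zero) (⋀⊩ (f ∘ suc) (ds ∘ suc))

⋁⊩ : ∀ {m} (f : Fin (suc m) → Fml n) j → ⊩[ a ] fml (f j) ∷ Γ →
     ⊩[ a ] fml (bigOr f) ∷ Γ
⋁⊩ {m = zero}  f zero    d = d
⋁⊩ {m = suc m} f zero    d = ∨⊩ (⊩-≈ (⊩-weaken (top [ _ ]) d) swap)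
⋁⊩ {m = suc m} f (suc j) d = ∨⊩ (⊩-weaken (top [ _ ]) (⋁⊩ (f ∘ suc) j d))

box-dia⊩ : ⊩[ a ] fml Y ∷ fml Z ∷ [] → ⊩[ a ] fml (box i Y) ∷ fml (dia i Z) ∷ []
box-dia⊩ {Y = Y} {Z = Z} {i = i} d =
  □⊩ (⊩-≈ (◇⊩ {Δ = [ fml Y ]} (⊩-weaken (inBox [ fml (dia i Z) ] i (top [])) d)) swap)

box-dia-dia⊩ : ⊩[ a ] fml Y ∷ fml Z ∷ fml Z′ ∷ [] →
               ⊩[ a ] fml (box i Y) ∷ fml (dia i Z) ∷ fml (dia i Z′) ∷ []
box-dia-dia⊩ {Y = Y} {Z = Z} {Z′ = Z′} {i = i} d =
  □⊩ (⊩-≈ (◇⊩ {Δ = [ fml Y ]} (⊩-≈ (◇⊩ {Δ = fml Y ∷ fml Z ∷ []} in-box) reverse₃)) swap)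
  where
    in-box : ⊩[ _ ] fml (dia i Z′) ∷ bx i (fml Y ∷ fml Z ∷ fml Z′ ∷ []) ∷ fml (dia i Z) ∷ []
    in-box = ⊩-≈ (⊩-weaken (inBox (fml (dia i Z) ∷ fml (dia i Z′) ∷ []) i (top [])) d)
                 (rotate [ _ ])

□◇⊩ : ⊩[ a ] fml Y ∷ fml Z ∷ [] → ⊩[ a ] fml (□ Y) ∷ fml (◇ Z) ∷ []
□◇⊩ {Z = Z} d = ⋀⊩ _ λ i → ⊩-≈ (⋁⊩ (λ j → dia j Z) i (⊩-≈ (box-dia⊩ d) swap)) swap

□^◇^⊩ : ∀ k → ⊩[ a ] fml Y ∷ fml Z ∷ [] → ⊩[ a ] fml (□^ k Y) ∷ fml (◇^ k Z) ∷ []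
□^◇^⊩ zero    d = d
□^◇^⊩ (suc k) d = □◇⊩ (□^◇^⊩ k d)

C-identity⊩ : ⊩[ a ] fml A ∷ fml (neg A) ∷ [] →
              ⊩[ suc a ] fml (ck A) ∷ fml (cdual (neg A)) ∷ []
C-identity⊩ {A = A} d = ⊩-≈ (C⊩ (top [ fml (cdual (neg A)) ]) λ k →
  C̃⊩ k (⊩-≈ (⊩-weaken (top [ _ ]) (□^◇^⊩ (suc k) d)) (cons fmlr swap))) swap

∈-pair-↭ : {x y : Fml n} {c : List (Fml n)} → x ∈ c → y ∈ c → x ≢ y →
           ∃[ c′ ] c ↭ x ∷ y ∷ c′
∈-pair-↭ {x = x} x∈c y∈c x≢y with ys , zs , refl ← ∈-∃++ x∈c
  with ↭.∈-resp-↭ (↭.shift x ys zs) y∈c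
... | here y≡x  = ⊥-elim (x≢y (sym y≡x))
... | there y∈ with us , vs , eq ← ∈-∃++ y∈ =
  us ++ vs , ↭-trans (↭.shift x ys zs) (prep x (↭-trans (↭-reflexive eq) (↭.shift _ us vs)))

complementary⊩ : (c : List (Fml n)) → ⊩ fml X ∷ fml (neg X) ∷ [] →
                 X ∈ c → neg X ∈ c → ⊩ map fml c
complementary⊩ {X = X} _ d X∈c ¬X∈c with c′ , c↭ ← ∈-pair-↭ X∈c ¬X∈c (neg-irreflexive X) =
  exchange⊩ (weaken⊩ (top (map fml c′)) d)
            (↭⇒≈ (↭-trans (↭.++-comm (map fml c′) _) (↭-sym (↭.map⁺ fml c↭))))

identity : (A : Fml n) → ⊩ fml A ∷ fml (neg A) ∷ []
identity (atom p)  = 0 , 0 , ax (top []) p (≈-refl _)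
identity (natom p) = 0 , 0 , ax (top []) p swap
identity (A ∨f B)  = ⊩-lift₁ (λ d → ∨⊩ (⊩-≈ d (rotate [ _ ])))
  (⊩-lift₂ ∧⊩
    (complementary⊩ (neg A ∷ A ∷ B ∷ []) (identity A) (there (here refl)) (here refl))
    (complementary⊩ (neg B ∷ A ∷ B ∷ []) (identity B) (there (there (here refl))) (here refl)))
identity (A ∧f B)  = ⊩-lift₁ (λ d → ⊩-≈ (∨⊩ (⊩-≈ d (rotate [ _ ]))) swap)
  (⊩-lift₂ ∧⊩
    (complementary⊩ (A ∷ neg A ∷ neg B ∷ []) (identity A) (here refl) (there (here refl)))
    (complementary⊩ (B ∷ neg A ∷ neg B ∷ []) (identity B) (here refl) (there (there (here refl)))))
identity (box i A) = ⊩-lift₁ box-dia⊩ (identity A)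
identity (dia i A) = ⊩-lift₁ (λ d → ⊩-≈ (box-dia⊩ (⊩-≈ d swap)) swap) (identity A)
identity (ck A) with a , d ← identity A = suc a , C-identity⊩ d
identity (cdual A) with a , d ← identity A =
  suc a , ⊩-≈ (subst (λ B → ⊩[ suc a ] fml (ck (neg A)) ∷ fml (cdual B) ∷ []) (neg-involutive A)
                     (C-identity⊩ Ā,Ā̄)) swap
  where
    Ā,Ā̄ : ⊩[ a ] fml (neg A) ∷ fml (neg (neg A)) ∷ []
    Ā,Ā̄ = subst (λ B → ⊩[ a ] fml (neg A) ∷ fml B ∷ []) (sym (neg-involutive A)) (⊩-≈ d swap)

_≟_ : DecidableEquality (Fml n)
atom p ≟ atom q with p ℕ.≟ q
... | yes refl = yes refl
... | no p≢q   = no λ { refl → p≢q refl }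
natom p ≟ natom q with p ℕ.≟ q
... | yes refl = yes refl
... | no p≢q   = no λ { refl → p≢q refl }
(A ∨f B) ≟ (A′ ∨f B′) with A ≟ A′ | B ≟ B′
... | yes refl | yes refl = yes refl
... | no A≢A′  | _        = no λ { refl → A≢A′ refl }
... | _        | no B≢B′  = no λ { refl → B≢B′ refl }
(A ∧f B) ≟ (A′ ∧f B′) with A ≟ A′ | B ≟ B′
... | yes refl | yes refl = yes refl
... | no A≢A′  | _        = no λ { refl → A≢A′ refl }
... | _        | no B≢B′  = no λ { refl → B≢B′ refl }
dia i A ≟ dia j B with i Fin.≟ j | A ≟ B
... | yes refl | yes refl = yes refl
... | no i≢j   | _        = no λ { refl → i≢j refl }
... | _        | no A≢B   = no λ { refl → A≢B refl }
box i A ≟ box j B with i Fin.≟ j | A ≟ B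
... | yes refl | yes refl = yes refl
... | no i≢j   | _        = no λ { refl → i≢j refl }
... | _        | no A≢B   = no λ { refl → A≢B refl }
cdual A ≟ cdual B with A ≟ B
... | yes refl = yes refl
... | no A≢B   = no λ { refl → A≢B refl }
ck A ≟ ck B with A ≟ B
... | yes refl = yes refl
... | no A≢B   = no λ { refl → A≢B refl }
atom _ ≟ natom _ = no λ ()
atom _ ≟ (_ ∨f _) = no λ ()
atom _ ≟ (_ ∧f _) = no λ ()
atom _ ≟ dia _ _ = no λ ()
atom _ ≟ box _ _ = no λ ()
atom _ ≟ cdual _ = no λ ()
atom _ ≟ ck _ = no λ ()
natom _ ≟ atom _ = no λ ()
natom _ ≟ (_ ∨f _) = no λ ()
natom _ ≟ (_ ∧f _) = no λ ()
natom _ ≟ dia _ _ = no λ ()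
natom _ ≟ box _ _ = no λ ()
natom _ ≟ cdual _ = no λ ()
natom _ ≟ ck _ = no λ ()
(_ ∨f _) ≟ atom _ = no λ ()
(_ ∨f _) ≟ natom _ = no λ ()
(_ ∨f _) ≟ (_ ∧f _) = no λ ()
(_ ∨f _) ≟ dia _ _ = no λ ()
(_ ∨f _) ≟ box _ _ = no λ ()
(_ ∨f _) ≟ cdual _ = no λ ()
(_ ∨f _) ≟ ck _ = no λ ()
(_ ∧f _) ≟ atom _ = no λ ()
(_ ∧f _) ≟ natom _ = no λ ()
(_ ∧f _) ≟ (_ ∨f _) = no λ ()
(_ ∧f _) ≟ dia _ _ = no λ ()
(_ ∧f _) ≟ box _ _ = no λ ()
(_ ∧f _) ≟ cdual _ = no λ ()
(_ ∧f _) ≟ ck _ = no λ ()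
dia _ _ ≟ atom _ = no λ ()
dia _ _ ≟ natom _ = no λ ()
dia _ _ ≟ (_ ∨f _) = no λ ()
dia _ _ ≟ (_ ∧f _) = no λ ()
dia _ _ ≟ box _ _ = no λ ()
dia _ _ ≟ cdual _ = no λ ()
dia _ _ ≟ ck _ = no λ ()
box _ _ ≟ atom _ = no λ ()
box _ _ ≟ natom _ = no λ ()
box _ _ ≟ (_ ∨f _) = no λ ()
box _ _ ≟ (_ ∧f _) = no λ ()
box _ _ ≟ dia _ _ = no λ ()
box _ _ ≟ cdual _ = no λ ()
box _ _ ≟ ck _ = no λ ()
cdual _ ≟ atom _ = no λ ()
cdual _ ≟ natom _ = no λ ()
cdual _ ≟ (_ ∨f _) = no λ ()
cdual _ ≟ (_ ∧f _) = no λ ()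
cdual _ ≟ dia _ _ = no λ ()
cdual _ ≟ box _ _ = no λ ()
cdual _ ≟ ck _ = no λ ()
ck _ ≟ atom _ = no λ ()
ck _ ≟ natom _ = no λ ()
ck _ ≟ (_ ∨f _) = no λ ()
ck _ ≟ (_ ∧f _) = no λ ()
ck _ ≟ dia _ _ = no λ ()
ck _ ≟ box _ _ = no λ ()
ck _ ≟ cdual _ = no λ ()

-- eval treats every formula other than a conjunction or disjunction as an atom.
Literal : Fml n → Set
Literal (_ ∨f _) = ⊥
Literal (_ ∧f _) = ⊥
Literal _        = ⊤

eval-literal : (V : Fml n → Bool) → Literal X → eval V X ≡ V X ⊎ eval V X ≡ not (V (neg X))
eval-literal {X = atom _}  V _ = inj₁ refl
eval-literal {X = natom _} V _ = inj₂ refl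
eval-literal {X = dia _ _} V _ = inj₂ refl
eval-literal {X = box _ _} V _ = inj₁ refl
eval-literal {X = cdual _} V _ = inj₂ refl
eval-literal {X = ck _}    V _ = inj₁ refl

module _ (c : List (Fml n)) where
  open import Data.List.Membership.DecPropositional (_≟_ {n}) using (_∈?_)

  -- The valuation making every literal of c false unless its complement is in c as well.
  falsifier : Fml n → Bool
  falsifier Y = ⌊ neg Y ∈? c ⌋

  falsifier-complement : Literal X → X ∈ c → T (eval falsifier X) → neg X ∈ c
  falsifier-complement {X = X} lit X∈c t with eval-literal falsifier lit
  ... | inj₁ eq = toWitness (subst T eq t)
  ... | inj₂ eq =
    ⊥-elim (toWitnessFalse (subst T eq t) (subst (_∈ c) (sym (neg-involutive X)) X∈c))

complementary : (c : List (Fml n)) → X ∈ c → neg X ∈ c → ⊩ map fml c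
complementary {X = X} c = complementary⊩ c (identity X)

valid-clause⊩ : (c : List (Fml n)) → (∀ {X} → X ∈ c → Literal X) →
                (∀ V → Any (T ∘ eval V) c) → ⊩ map fml c
valid-clause⊩ c lits valid with X , X∈c , t ← find (valid (falsifier c)) =
  complementary c X∈c (falsifier-complement c (lits X∈c) X∈c t)

clauses : Fml n → List (List (Fml n))
clauses (A ∨f B) = cartesianProductWith _++_ (clauses A) (clauses B)
clauses (A ∧f B) = clauses A ++ clauses B
clauses A        = [ [ A ] ]

clauses-literal : (A : Fml n) {c : List (Fml n)} → c ∈ clauses A → X ∈ c → Literal X
clauses-literal (A ∨f B) c∈ X∈c
  with c₁ , c₂ , c₁∈ , c₂∈ , refl ← ∈-cartesianProductWith⁻ _++_ (clauses A) (clauses B) c∈ =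
  [ clauses-literal A c₁∈ , clauses-literal B c₂∈ ]′ (∈-++⁻ c₁ X∈c)
clauses-literal (A ∧f B) c∈ X∈c =
  [ (λ c∈A → clauses-literal A c∈A X∈c) , (λ c∈B → clauses-literal B c∈B X∈c) ]′
    (∈-++⁻ (clauses A) c∈)
clauses-literal (atom _)  (here refl) (here refl) = tt
clauses-literal (natom _) (here refl) (here refl) = tt
clauses-literal (dia _ _) (here refl) (here refl) = tt
clauses-literal (box _ _) (here refl) (here refl) = tt
clauses-literal (cdual _) (here refl) (here refl) = tt
clauses-literal (ck _)    (here refl) (here refl) = tt

clauses-true : (V : Fml n → Bool) (A : Fml n) {c : List (Fml n)} →
               T (eval V A) → c ∈ clauses A → Any (T ∘ eval V) c
clauses-true V (A ∨f B) t c∈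
  with c₁ , c₂ , c₁∈ , c₂∈ , refl ← ∈-cartesianProductWith⁻ _++_ (clauses A) (clauses B) c∈
  with Equivalence.to T-∨ t
... | inj₁ tA = Any.++⁺ˡ (clauses-true V A tA c₁∈)
... | inj₂ tB = Any.++⁺ʳ c₁ (clauses-true V B tB c₂∈)
clauses-true V (A ∧f B) t c∈ with tA , tB ← Equivalence.to T-∧ t =
  [ clauses-true V A tA , clauses-true V B tB ]′ (∈-++⁻ (clauses A) c∈)
clauses-true V (atom _)  t (here refl) = here t
clauses-true V (natom _) t (here refl) = here t
clauses-true V (dia _ _) t (here refl) = here t
clauses-true V (box _ _) t (here refl) = here t
clauses-true V (cdual _) t (here refl) = here t
clauses-true V (ck _)    t (here refl) = here t

clauses⊩ : (A : Fml n) (Δ : Seq n) → (∀ {c} → c ∈ clauses A → ⊩ map fml c ++ Δ) →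
           ⊩ fml A ∷ Δ
clauses⊩ (A ∨f B) Δ ds = ⊩-lift₁ ∨⊩ (clauses⊩ A (fml B ∷ Δ) λ {c₁} c₁∈ →
  exchange⊩ (clauses⊩ B (map fml c₁ ++ Δ) λ {c₂} c₂∈ →
               exchange⊩ (ds (∈-cartesianProductWith⁺ _++_ c₁∈ c₂∈)) (↭⇒≈ (reassociate c₁ c₂)))
            (↭⇒≈ (↭-sym (↭.shift (fml B) (map fml c₁) Δ))))
  where
    reassociate : ∀ c₁ c₂ → (map fml (c₁ ++ c₂) ++ Δ) ↭ (map fml c₂ ++ map fml c₁ ++ Δ)
    reassociate c₁ c₂ = ↭-trans
      (↭-reflexive (≡.trans (cong (_++ Δ) (map-++ fml c₁ c₂)) (++-assoc (map fml c₁) _ Δ)))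
      (↭.shifts (map fml c₁) (map fml c₂))
clauses⊩ (A ∧f B) Δ ds =
  ⊩-lift₂ ∧⊩ (clauses⊩ A Δ (ds ∘ ∈-++⁺ˡ)) (clauses⊩ B Δ (ds ∘ ∈-++⁺ʳ (clauses A)))
clauses⊩ (atom _)  Δ ds = ds (here refl)
clauses⊩ (natom _) Δ ds = ds (here refl)
clauses⊩ (dia _ _) Δ ds = ds (here refl)
clauses⊩ (box _ _) Δ ds = ds (here refl)
clauses⊩ (cdual _) Δ ds = ds (here refl)
clauses⊩ (ck _)    Δ ds = ds (here refl)

tautology⊩ : (A : Fml n) → Taut A → ⊩ fml A ∷ []
tautology⊩ A valid = clauses⊩ A [] λ {c} c∈ →
  subst ⊩_ (sym (++-identityʳ (map fml c)))
    (valid-clause⊩ c (clauses-literal A c∈)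
                     (λ V → clauses-true V A (Equivalence.from T-≡ (valid V)) c∈))

∨-inv⊩ : ⊩ fml (X ∨f Y) ∷ [] → ⊩ fml X ∷ fml Y ∷ []
∨-inv⊩ {X = X} {Y = Y} d = ⊩-lift₂ cut⊩
  (exchange⊩ (weaken⊩ (top (fml X ∷ fml Y ∷ [])) d) (rotate (_ ∷ _ ∷ [])))
  (⊩-lift₂ ∧⊩ (complementary (neg X ∷ X ∷ Y ∷ []) (there (here refl)) (here refl))
             (complementary (neg Y ∷ X ∷ Y ∷ []) (there (there (here refl))) (here refl)))

∧-invˡ⊩ : ⊩ fml (X ∧f Y) ∷ fml Z ∷ [] → ⊩ fml X ∷ fml Z ∷ []
∧-invˡ⊩ {X = X} {Y = Y} {Z = Z} d = ⊩-lift₂ cut⊩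
  (exchange⊩ (weaken⊩ (top [ fml X ]) d) swap)
  (⊩-lift₁ ∨⊩ (complementary (neg X ∷ neg Y ∷ X ∷ Z ∷ []) (there (there (here refl))) (here refl)))

∧-invʳ⊩ : ⊩ fml (X ∧f Y) ∷ fml Z ∷ [] → ⊩ fml Y ∷ fml Z ∷ []
∧-invʳ⊩ {X = X} {Y = Y} {Z = Z} d = ⊩-lift₂ cut⊩
  (exchange⊩ (weaken⊩ (top [ fml Y ]) d) swap)
  (⊩-lift₁ ∨⊩
    (complementary (neg X ∷ neg Y ∷ Y ∷ Z ∷ []) (there (there (here refl))) (there (here refl))))

modus-ponens⊩ : ⊩ fml A ∷ [] → ⊩ fml (A ⊃ B) ∷ [] → ⊩ fml B ∷ []
modus-ponens⊩ dA dA⊃B = ⊩-lift₂ cut⊩ (exchange⊩ (weaken⊩ (top [ _ ]) dA) swap) (∨-inv⊩ dA⊃B)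

necessitation⊩ : ⊩ fml A ∷ [] → ⊩ fml (box i A) ∷ []
necessitation⊩ {i = i} = ⊩-lift₁ (□⊩ ∘ ⊩-weaken (inBox [] i (top [])))

K⊩ : ⊩ fml ((box i A ∧f box i (A ⊃ B)) ⊃ box i B) ∷ []
K⊩ {A = A} {B = B} = ⊩-lift₁ (λ d → ∨⊩ (∨⊩ (⊩-≈ (box-dia-dia⊩ d) (rotate [ _ ]))))
  (exchange⊩ (⊩-lift₂ ∧⊩
    (complementary (neg (neg A) ∷ B ∷ neg A ∷ []) (there (there (here refl))) (here refl))
    (complementary (neg B ∷ B ∷ neg A ∷ []) (there (here refl)) (here refl))) (rotate [ _ ]))

C-axiom⊩ : ⊩ fml (ck A ⊃ (□ A ∧f □ (ck A))) ∷ []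
C-axiom⊩ {A = A} with a , d ← identity A =
  ⊩-lift₁ (λ e → ∨⊩ (⊩-≈ e swap)) (⊩-lift₂ ∧⊩ (a , □A) (suc a , □CA))
  where
    C̃Ā = cdual (neg A)
    □A : ⊩[ a ] fml (□ A) ∷ fml C̃Ā ∷ []
    □A = ⊩-≈ (C̃⊩ 0 (⊩-≈ (⊩-weaken (top [ _ ]) (□◇⊩ d)) (cons fmlr swap))) swap
    premise : ∀ i k → ⊩[ a ] fml C̃Ā ∷ bx i [ fml (□^ (suc k) A) ] ∷ []
    premise i k =
      C̃⊩ (suc k) (⊩-≈ (⋁⊩ (λ j → dia j ◇ᵏ⁺¹Ā) i (◇⊩ {Δ = [ _ ]} in-box)) (rotate (_ ∷ _ ∷ [])))
      where
        ◇ᵏ⁺¹Ā = ◇^ (suc k) (neg A)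
        in-box : ⊩[ a ] fml (dia i ◇ᵏ⁺¹Ā) ∷ bx i (fml (□^ (suc k) A) ∷ fml ◇ᵏ⁺¹Ā ∷ [])
                          ∷ fml C̃Ā ∷ []
        in-box = ⊩-≈ (⊩-weaken (inBox (fml C̃Ā ∷ fml (dia i ◇ᵏ⁺¹Ā) ∷ []) i (top []))
                               (□^◇^⊩ (suc k) d))
                     (rotate [ _ ])
    □CA : ⊩[ suc a ] fml (□ (ck A)) ∷ fml C̃Ā ∷ []
    □CA = ⋀⊩ _ λ i → □⊩ (⊩-≈ (C⊩ (inBox [ fml C̃Ā ] i (top [])) (premise i)) swap)

-- B ⊃ □ᵏ⁺¹Y by induction on k, simultaneously for Y = A and Y = B.
C-induction⊩ : ⊩[ a ] fml (□ A) ∷ fml (neg B) ∷ [] → ⊩[ a ] fml (□ B) ∷ fml (neg B) ∷ [] →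
               ⊩[ suc a ] fml (B ⊃ ck A) ∷ []
C-induction⊩ {a = a} {A = A} {B = B} B⊃□A B⊃□B =
  ∨⊩ (C⊩ (top [ fml (neg B) ]) (B⊃□ᵏ⁺¹ B⊃□A))
  where
    □ᵏB⊃□ᵏ⁺¹Y : ∀ {Y} k → ⊩[ a ] fml (□ Y) ∷ fml (neg B) ∷ [] →
                ⊩[ a ] fml (neg (□^ k B)) ∷ fml (neg B) ∷ fml (□^ (suc k) Y) ∷ []
    □ᵏB⊃□ᵏ⁺¹Y {Y} k B⊃□Y =
      subst₂ (λ ¬□ᵏB □ᵏ⁺¹Y → ⊩[ a ] fml ¬□ᵏB ∷ fml (neg B) ∷ fml □ᵏ⁺¹Y ∷ [])
             (sym (neg-□^ k B)) (□^-□ k Y)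
        (⊩-≈ (⊩-weaken (top [ _ ]) (□^◇^⊩ k B⊃□Y)) (rotate (_ ∷ _ ∷ [])))
    B⊃□ᵏ⁺¹ : ∀ {Y} → ⊩[ a ] fml (□ Y) ∷ fml (neg B) ∷ [] →
             ∀ k → ⊩[ a ] fml (neg B) ∷ fml (□^ (suc k) Y) ∷ []
    B⊃□ᵏ⁺¹ B⊃□Y zero    = ⊩-≈ B⊃□Y swap
    B⊃□ᵏ⁺¹ B⊃□Y (suc k) =
      cut⊩ (⊩-≈ (⊩-weaken (top [ _ ]) (B⊃□ᵏ⁺¹ B⊃□B k)) reverse₃) (□ᵏB⊃□ᵏ⁺¹Y (suc k) B⊃□Y)

induction⊩ : ⊩ fml (B ⊃ (□ A ∧f □ B)) ∷ [] → ⊩ fml (B ⊃ ck A) ∷ []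
induction⊩ h = let a , B⊃□A , B⊃□B = ⊩-common (∧-invˡ⊩ B⊃□A∧□B) (∧-invʳ⊩ B⊃□A∧□B) in
  suc a , C-induction⊩ B⊃□A B⊃□B
  where B⊃□A∧□B = exchange⊩ (∨-inv⊩ h) swap

hilbert⊩ : HC⊢ A → ⊩ fml A ∷ []
hilbert⊩ (taut valid) = tautology⊩ _ valid
hilbert⊩ kax          = K⊩
hilbert⊩ cax          = C-axiom⊩
hilbert⊩ (ind h)      = induction⊩ (hilbert⊩ h)
hilbert⊩ (mp hA hA⊃B) = modus-ponens⊩ (hilbert⊩ hA) (hilbert⊩ hA⊃B)
hilbert⊩ (nec h)      = necessitation⊩ (hilbert⊩ h)

theorem3p22 : (n : ℕ) (A : Fml n) → HC⊢ A → ∃[ α ] (DC ω² ⊢[ α ] (fml A ∷ []))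
theorem3p22 _ _ h = let a , b , d = hilbert⊩ h in (a , b) , d
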